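{- For all positive integers $C,t$ there exists a positive integer $m$ such that $\chi^l_C(K_{t,m})\ge t+1$ and $\chi^l_C(I_{t-1}+P_m)\ge t+1$.
   Context: $I_n+P_m$ denotes a path on $m$ vertices together with $n$ additional pairwise non-adjacent vertices each adjacent to all vertices of the path. A $t$-list assignment $L$ for $G$ assigns to each vertex $v$ a finite set $L(v)$ with $|L(v)|\ge t$; an $L$-coloring with clustering $C$ assigns each vertex $v$ a color from $L(v)$ such that every monochromatic connected subgraph has at most $C$ vertices. $\chi^l_C(G)$ is the minimum $t$ such that $G$ has an $L$-coloring with clustering $C$ for every $t$-list assignment $L$. -}

module Defs where

open import Data.Nat using (ℕ; zero; suc; _≤_)
open import Data.Fin using (Fin; toℕ)
open import Data.Sum using (_⊎_; inj₁; inj₂)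
open import Data.Unit using (⊤)
open import Data.Empty using (⊥)
open import Data.Product using (Σ; _×_)
open import Data.List using (List; length)
open import Data.List.Relation.Unary.All using (All)
open import Data.List.Relation.Unary.Unique.Propositional using (Unique)
open import Data.List.Membership.Propositional using (_∈_)
open import Relation.Binary.PropositionalEquality using (_≡_)

-- A finite simple graph: a vertex set given as a type (always finite below)
-- with a symmetric, irreflexive adjacency relation.
record Graph : Set₁ where
  field
    V   : Set
    Adj : V → V → Set
    sym : ∀ {u v} → Adj u v → Adj v u
    irr : ∀ {v} → Adj v v → ⊥
open Graph public

-- Colours are natural numbers; a list assignment gives each vertex a finite
-- set of colours, represented as a duplicate-free list.
ListAssignment : Graph → Set
ListAssignment G = V G → List ℕ

IsTListAssignment : (G : Graph) → ℕ → ListAssignment G → Set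
IsTListAssignment G t L = ∀ v → Unique (L v) × (t ≤ length (L v))

data MonoReach (G : Graph) (c : V G → ℕ) (v : V G) : V G → Set where
  here : MonoReach G c v v
  step : ∀ {u w} → MonoReach G c v u → Adj G u w → c w ≡ c v → MonoReach G c v w

-- Every monochromatic connected subgraph has at most C vertices:
-- equivalently every monochromatic component has at most C vertices,
-- i.e. any list of distinct vertices all lying in the monochromatic
-- component of v has length ≤ C.
HasClustering : (G : Graph) → (c : V G → ℕ) → ℕ → Set
HasClustering G c C =
  ∀ (v : V G) (xs : List (V G)) → Unique xs → All (MonoReach G c v) xs → length xs ≤ C

LColouring : (G : Graph) → ListAssignment G → ℕ → Set
LColouring G L C =
  Σ (V G → ℕ) λ c → (∀ v → c v ∈ L v) × HasClustering G c C

ListColourableClustered : Graph → ℕ → ℕ → Set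
ListColourableClustered G C t =
  ∀ (L : ListAssignment G) → IsTListAssignment G t L → LColouring G L C

-- χ^l_C(G) ≥ s : every t with the defining property of χ^l_C(G) satisfies s ≤ t
-- (χ^l_C(G) is the minimum such t).
ChiListClusteredGE : Graph → ℕ → ℕ → Set
ChiListClusteredGE G C s = ∀ t → ListColourableClustered G C t → s ≤ t

K : ℕ → ℕ → Graph
K a b = record { V = Fin a ⊎ Fin b ; Adj = adj ; sym = sy ; irr = ir }
  where
  adj : Fin a ⊎ Fin b → Fin a ⊎ Fin b → Set
  adj (inj₁ _) (inj₂ _) = ⊤
  adj (inj₂ _) (inj₁ _) = ⊤
  adj (inj₁ _) (inj₁ _) = ⊥
  adj (inj₂ _) (inj₂ _) = ⊥
  sy : ∀ {u v} → adj u v → adj v u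
  sy {inj₁ _} {inj₂ _} p = p
  sy {inj₂ _} {inj₁ _} p = p
  ir : ∀ {v} → adj v v → ⊥
  ir {inj₁ _} p = p
  ir {inj₂ _} p = p

PathAdj : ∀ {m} → Fin m → Fin m → Set
PathAdj i j = (toℕ j ≡ suc (toℕ i)) ⊎ (toℕ i ≡ suc (toℕ j))

IP : ℕ → ℕ → Graph
IP n m = record { V = Fin n ⊎ Fin m ; Adj = adj ; sym = sy ; irr = ir }
  where
  adj : Fin n ⊎ Fin m → Fin n ⊎ Fin m → Set
  adj (inj₁ _) (inj₂ _) = ⊤
  adj (inj₂ _) (inj₁ _) = ⊤
  adj (inj₁ _) (inj₁ _) = ⊥
  adj (inj₂ i) (inj₂ j) = PathAdj i j
  sy : ∀ {u v} → adj u v → adj v u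
  sy {inj₁ _} {inj₂ _} p = p
  sy {inj₂ _} {inj₁ _} p = p
  sy {inj₂ _} {inj₂ _} (inj₁ p) = inj₂ p
  sy {inj₂ _} {inj₂ _} (inj₂ p) = inj₁ p
  ir : ∀ {v} → adj v v → ⊥
  ir {inj₁ _} p = p
  ir {inj₂ i} (inj₁ p) = noloop p
    where
    noloop : ∀ {k : ℕ} → k ≡ suc k → ⊥
    noloop ()
  ir {inj₂ i} (inj₂ p) = noloop p
    where
    noloop : ∀ {k : ℕ} → k ≡ suc k → ⊥
    noloop ()

-- Give the hub vertex i the colours (i,0),…,(i,t-1). A colouring then picks one colour d i for
-- each hub, i.e. a choice function d. For every d the construction contains many vertices whose
-- list is {(i, d i) : i}, each adjacent to all hubs: each must repeat the colour of some hub, so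
-- by pigeonhole some hub shares its colour with more than C of them, a monochromatic star that is
-- too large. In I_{t-1} + P_m the path vertices get the extra colour 0 and come in blocks of C+1
-- consecutive vertices; a block entirely coloured 0 is a monochromatic path that is too long,
-- and otherwise every block supplies one neighbour of the hubs as above.
module Submission where

open import Defs hiding (sym)
open import Data.Nat using (ℕ; zero; suc; _≤_; _<_; _+_; _*_; _∸_; _^_; z≤n; s≤s; s≤s⁻¹; _≟_; _≤?_; _<?_)
open import Data.Nat.Properties
open import Data.Fin using (Fin; zero; suc; toℕ; fromℕ<; inject₁; combine; quotient; remainder; finToFun; funToFin)
open import Data.Fin.Properties
  using (toℕ-injective; toℕ-inject₁; toℕ-fromℕ<; toℕ<n; toℕ-combine; remQuot-combine; combine-injective; finToFun-funToFin; any?; all?; ¬∀⟶∃¬)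
open import Data.List using (List; []; _∷_; length; map; tabulate; allFin; filter)
open import Data.List.Properties using (length-map; length-tabulate)
open import Data.List.Relation.Unary.All using (All; _∷_)
import Data.List.Relation.Unary.All as All
import Data.List.Relation.Unary.All.Properties as All
open import Data.List.Relation.Unary.Any using (here; there)
open import Data.List.Relation.Unary.Unique.Propositional using (Unique; _∷_)
import Data.List.Relation.Unary.Unique.Propositional.Properties as Unique
open import Data.List.Membership.Propositional using (_∈_)
open import Data.List.Membership.Propositional.Properties using (∈-tabulate⁻)
open import Data.Product using (Σ; _×_; _,_; proj₁; proj₂)
open import Data.Sum using (inj₁; inj₂)
open import Data.Sum.Properties using (inj₂-injective)
open import Data.Unit using (tt)
open import Data.Empty using (⊥; ⊥-elim)
open import Function using (_∘_)
open import Relation.Nullary using (¬_; Dec; yes; no)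
open import Relation.Unary using (Decidable)
open import Relation.Unary.Properties using (∁?)
open import Relation.Binary.PropositionalEquality using (_≡_; _≢_; _≗_; refl; sym; trans; cong; subst; module ≡-Reasoning)

length-filter-∁ : ∀ {X : Set} {P : X → Set} (P? : Decidable P) (xs : List X) →
  length xs ≡ length (filter P? xs) + length (filter (∁? P?) xs)
length-filter-∁ P? [] = refl
length-filter-∁ P? (x ∷ xs) with P? x
... | yes _ = cong suc (length-filter-∁ P? xs)
... | no _ = trans (cong suc (length-filter-∁ P? xs)) (sym (+-suc _ _))

pigeonhole : ∀ {X : Set} (f : X → ℕ) n C (xs : List X) → Unique xs → All (λ x → f x < n) xs →
  n * C < length xs →
  Σ ℕ λ k → k < n × Σ (List X) λ zs → Unique zs × All (λ x → f x ≡ k) zs × C < length zs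
pigeonhole f zero C [] _ _ ()
pigeonhole f zero C (x ∷ xs) _ (() ∷ _) _
pigeonhole f (suc n) C xs xs-unique f<1+n big = split (C <? length (filter top? xs))
  where
  top? : Decidable (λ x → f x ≡ n)
  top? x = f x ≟ n
  rest<n : All (λ x → f x < n) (filter (∁? top?) xs)
  rest<n = All.zipWith (λ (lt , ne) → ≤∧≢⇒< (s≤s⁻¹ lt) ne)
             (All.filter⁺ (∁? top?) f<1+n , All.all-filter (∁? top?) xs)
  rest-big : ¬ C < length (filter top? xs) → n * C < length (filter (∁? top?) xs)
  rest-big fibre-small = +-cancelˡ-< C _ _ (<-≤-trans big (begin
    length xs                                                ≡⟨ length-filter-∁ top? xs ⟩
    length (filter top? xs) + length (filter (∁? top?) xs)   ≤⟨ +-monoˡ-≤ _ (≮⇒≥ fibre-small) ⟩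
    C + length (filter (∁? top?) xs)                         ∎))
    where open ≤-Reasoning
  split : Dec (C < length (filter top? xs)) →
    Σ ℕ λ k → k < suc n × Σ (List _) λ zs → Unique zs × All (λ x → f x ≡ k) zs × C < length zs
  split (yes fibre-big) = n , n<1+n n , filter top? xs , Unique.filter⁺ top? xs-unique , All.all-filter top? xs , fibre-big
  split (no fibre-small)
    with k , k<n , fibre ← pigeonhole f n C (filter (∁? top?) xs) (Unique.filter⁺ (∁? top?) xs-unique) rest<n (rest-big fibre-small)
    = k , m≤n⇒m≤1+n k<n , fibre

module _ {G : Graph} {c : V G → ℕ} {C : ℕ} where

  ¬clustered-star : ∀ {n} (hub : Fin n → V G) (leaf : Fin (suc (n * C)) → V G) →
    (∀ {r r′} → leaf r ≡ leaf r′ → r ≡ r′) →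
    (∀ r → Σ (Fin n) λ i → Adj G (hub i) (leaf r) × c (leaf r) ≡ c (hub i)) →
    ¬ HasClustering G c C
  ¬clustered-star {n} hub leaf leaf-injective attach clustered
    with k , k<n , zs , zs-unique , F≡k , C<zs ← pigeonhole (toℕ ∘ proj₁ ∘ attach) n C (allFin _)
           (Unique.allFin⁺ _) (All.tabulate⁺ (toℕ<n ∘ proj₁ ∘ attach)) (≤-reflexive (sym (length-tabulate (λ r → r))))
    = <⇒≱ C<zs (subst (_≤ C) (length-map leaf zs)
        (clustered (hub i) (map leaf zs) (Unique.map⁺ leaf-injective zs-unique) (All.map⁺ (All.map reach F≡k))))
    where
    i : Fin n
    i = fromℕ< k<n
    reach : ∀ {r} → toℕ (proj₁ (attach r)) ≡ k → MonoReach G c (hub i) (leaf r)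
    reach {r} e with attach r
    ... | _ , adj , same = subst (λ h → MonoReach G c (hub h) (leaf r))
                            (toℕ-injective (trans e (sym (toℕ-fromℕ< k<n)))) (step here adj same)

  path-reach : ∀ {k} (p : Fin (suc k) → V G) → (∀ s → Adj G (p (inject₁ s)) (p (suc s))) →
    (∀ s → c (p s) ≡ c (p zero)) → ∀ s → MonoReach G c (p zero) (p s)
  path-reach p adj same zero = here
  path-reach {suc k} p adj same (suc s) =
    step (path-reach (p ∘ inject₁) (adj ∘ inject₁) (same ∘ inject₁) s) (adj s) (same (suc s))

  ¬clustered-path : (p : Fin (suc C) → V G) → (∀ {s s′} → p s ≡ p s′ → s ≡ s′) →
    (∀ s → Adj G (p (inject₁ s)) (p (suc s))) → (∀ s → c (p s) ≡ c (p zero)) →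
    ¬ HasClustering G c C
  ¬clustered-path p p-injective adj same clustered =
    <⇒≱ (≤-reflexive (sym (length-tabulate p)))
      (clustered (p zero) (tabulate p) (Unique.tabulate⁺ p-injective) (All.tabulate⁺ (path-reach p adj same)))

uncolourable⇒χ>t : ∀ {G C t} (L : ListAssignment G) → IsTListAssignment G t L → ¬ LColouring G L C →
  ChiListClusteredGE G C (t + 1)
uncolourable⇒χ>t {t = t} L L-size uncolourable t′ colourable with t′ ≤? t
... | yes t′≤t = ⊥-elim (uncolourable (colourable L (λ v → proj₁ (L-size v) , ≤-trans t′≤t (proj₂ (L-size v)))))
... | no t′≰t = subst (_≤ t′) (+-comm 1 t) (≰⇒> t′≰t)

-- The pair (i , k) encoded injectively as a positive number; 0 stays free for the path in I_n + P_m.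
colour : ∀ {n t} → Fin n → Fin t → ℕ
colour i k = suc (toℕ (combine i k))

colour-injective : ∀ {n t} {i i′ : Fin n} {k k′ : Fin t} → colour i k ≡ colour i′ k′ → i ≡ i′ × k ≡ k′
colour-injective e = combine-injective _ _ _ _ (toℕ-injective (suc-injective e))

row : ∀ {n} t → Fin n → List ℕ
row t i = tabulate (colour {t = t} i)

transversal : ∀ {n t} → (Fin n → Fin t) → List ℕ
transversal d = tabulate (λ i → colour i (d i))

row-unique : ∀ {n} t (i : Fin n) → Unique (row t i)
row-unique t i = Unique.tabulate⁺ (λ e → proj₂ (colour-injective {i = i} {i′ = i} e))

transversal-unique : ∀ {n t} (d : Fin n → Fin t) → Unique (transversal d)
transversal-unique d = Unique.tabulate⁺ (λ {i} {i′} e → proj₁ (colour-injective {k = d i} {k′ = d i′} e))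

row-choice : ∀ {n t} {x : Fin n → ℕ} → (∀ i → x i ∈ row t i) → Σ (Fin n → Fin t) λ d → ∀ i → x i ≡ colour i (d i)
row-choice x∈row = (proj₁ ∘ ∈-tabulate⁻ ∘ x∈row) , (proj₂ ∘ ∈-tabulate⁻ ∘ x∈row)

∈-transversal : ∀ {n t y} {x : Fin n → ℕ} {d e : Fin n → Fin t} → (∀ i → x i ≡ colour i (d i)) → e ≗ d →
  y ∈ transversal e → Σ (Fin n) λ i → y ≡ x i
∈-transversal {x = x} {d} {e} x≡ e≗d y∈ with ∈-tabulate⁻ y∈
... | i , y≡ = i , trans y≡ (trans (cong (colour i) (e≗d i)) (sym (x≡ i)))

module CompleteBipartite {t C m : ℕ} (profile : Fin m → Fin t → Fin t)
  (copy : (Fin t → Fin t) → Fin (suc (t * C)) → Fin m)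
  (copy-injective : ∀ d {r r′} → copy d r ≡ copy d r′ → r ≡ r′)
  (profile-copy : ∀ d r → profile (copy d r) ≗ d) where

  lists : ListAssignment (K t m)
  lists (inj₁ i) = row t i
  lists (inj₂ j) = transversal (profile j)

  lists-size : IsTListAssignment (K t m) t lists
  lists-size (inj₁ i) = row-unique t i , ≤-reflexive (sym (length-tabulate (colour i)))
  lists-size (inj₂ j) = transversal-unique (profile j) , ≤-reflexive (sym (length-tabulate _))

  uncolourable : ¬ LColouring (K t m) lists C
  uncolourable (c , c∈L , clustered) with d , hub-colour ← row-choice (c∈L ∘ inj₁) =
    ¬clustered-star inj₁ leaf (copy-injective d ∘ inj₂-injective) attach clustered
    where
    leaf : Fin (suc (t * C)) → V (K t m)
    leaf r = inj₂ (copy d r)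
    attach : ∀ r → Σ (Fin t) λ i → Adj (K t m) (inj₁ i) (leaf r) × c (leaf r) ≡ c (inj₁ i)
    attach r with ∈-transversal hub-colour (profile-copy d r) (c∈L (leaf r))
    ... | i , same = i , tt , same

module PathJoin {n C m : ℕ} (profile : Fin m → Fin n → Fin (suc n))
  (segment : (Fin n → Fin (suc n)) → Fin (suc (n * C)) → Fin (suc C) → Fin m)
  (segment-injective : ∀ d {g s g′ s′} → segment d g s ≡ segment d g′ s′ → g ≡ g′ × s ≡ s′)
  (segment-consecutive : ∀ d g s → toℕ (segment d g (suc s)) ≡ suc (toℕ (segment d g (inject₁ s))))
  (profile-segment : ∀ d g s → profile (segment d g s) ≗ d) where

  lists : ListAssignment (IP n m)
  lists (inj₁ i) = row (suc n) i
  lists (inj₂ j) = 0 ∷ transversal (profile j)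

  lists-size : IsTListAssignment (IP n m) (suc n) lists
  lists-size (inj₁ i) = row-unique (suc n) i , ≤-reflexive (sym (length-tabulate (colour i)))
  lists-size (inj₂ j) = All.tabulate⁺ (λ _ ()) ∷ transversal-unique (profile j) , s≤s (≤-reflexive (sym (length-tabulate _)))

  uncolourable : ¬ LColouring (IP n m) lists C
  uncolourable (c , c∈L , clustered) with d , hub-colour ← row-choice (c∈L ∘ inj₁) =
    by-blocks (any? (λ g → all? (λ s → c (vertex g s) ≟ 0)))
    where
    vertex : Fin (suc (n * C)) → Fin (suc C) → V (IP n m)
    vertex g s = inj₂ (segment d g s)
    vertex-injective : ∀ {g s g′ s′} → vertex g s ≡ vertex g′ s′ → g ≡ g′ × s ≡ s′
    vertex-injective = segment-injective d ∘ inj₂-injective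
    by-blocks : Dec (Σ (Fin (suc (n * C))) λ g → ∀ s → c (vertex g s) ≡ 0) → ⊥
    by-blocks (yes (g , all-zero)) =
      ¬clustered-path (vertex g) (proj₂ ∘ vertex-injective) (λ s → inj₁ (segment-consecutive d g s))
        (λ s → trans (all-zero s) (sym (all-zero zero))) clustered
    by-blocks (no no-zero-block) = ¬clustered-star inj₁ leaf (proj₁ ∘ vertex-injective) attach clustered
      where
      nonzero : ∀ g → Σ (Fin (suc C)) λ s → c (vertex g s) ≢ 0
      nonzero g = ¬∀⟶∃¬ _ _ (λ s → c (vertex g s) ≟ 0) (λ all-zero → no-zero-block (g , all-zero))
      leaf : Fin (suc (n * C)) → V (IP n m)
      leaf g = vertex g (proj₁ (nonzero g))
      attach : ∀ g → Σ (Fin n) λ i → Adj (IP n m) (inj₁ i) (leaf g) × c (leaf g) ≡ c (inj₁ i)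
      attach g with c∈L (leaf g)
      ... | here is-zero = ⊥-elim (proj₂ (nonzero g) is-zero)
      ... | there c∈transversal with ∈-transversal hub-colour (profile-segment d g _) c∈transversal
      ...   | i , same = i , tt , same

quotient-combine : ∀ {a b} (i : Fin a) (j : Fin b) → quotient b (combine i j) ≡ i
quotient-combine i j = cong proj₁ (remQuot-combine i j)

remainder-combine : ∀ {a b} (i : Fin a) (j : Fin b) → remainder {a} b (combine i j) ≡ j
remainder-combine i j = cong proj₂ (remQuot-combine i j)

toℕ-combine-suc : ∀ {a b} (i : Fin a) {j j′ : Fin b} → toℕ j′ ≡ suc (toℕ j) →
  toℕ (combine i j′) ≡ suc (toℕ (combine i j))
toℕ-combine-suc {b = b} i {j} {j′} e = begin
  toℕ (combine i j′)       ≡⟨ toℕ-combine i j′ ⟩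
  b * toℕ i + toℕ j′       ≡⟨ cong (b * toℕ i +_) e ⟩
  b * toℕ i + suc (toℕ j)  ≡⟨ +-suc _ _ ⟩
  suc (b * toℕ i + toℕ j)  ≡⟨ cong suc (toℕ-combine i j) ⟨
  suc (toℕ (combine i j))  ∎
  where open ≡-Reasoning

-- Vertex index of copy r of profile d is ((d , r) , y₀); the Fin Y factor only pads m.
χ-K>t : ∀ t C Y → Fin Y → ChiListClusteredGE (K t (t ^ t * suc (t * C) * Y)) C (t + 1)
χ-K>t t C Y y₀ = uncolourable⇒χ>t lists lists-size uncolourable
  where
  profile : Fin (t ^ t * suc (t * C) * Y) → Fin t → Fin t
  profile j = finToFun (quotient (suc (t * C)) (quotient Y j))
  copy : (Fin t → Fin t) → Fin (suc (t * C)) → Fin (t ^ t * suc (t * C) * Y)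
  copy d r = combine (combine (funToFin d) r) y₀
  copy-injective : ∀ d {r r′} → copy d r ≡ copy d r′ → r ≡ r′
  copy-injective d {r} {r′} e =
    proj₂ (combine-injective (funToFin d) r (funToFin d) r′ (proj₁ (combine-injective _ y₀ _ y₀ e)))
  profile-copy : ∀ d r → profile (copy d r) ≗ d
  profile-copy d r i
    rewrite quotient-combine (combine (funToFin d) r) y₀ | quotient-combine (funToFin d) r = finToFun-funToFin d i
  open CompleteBipartite profile copy copy-injective profile-copy

-- Vertex index of position s in block g of profile d is (x₀ , (d , (g , s))); the innermost
-- factor makes each block a run of consecutive path vertices, and Fin X only pads m.
χ-IP>t : ∀ n C X → Fin X → ChiListClusteredGE (IP n (X * (suc n ^ n * (suc (n * C) * suc C)))) C (suc n + 1)
χ-IP>t n C X x₀ = uncolourable⇒χ>t lists lists-size uncolourable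
  where
  profile : Fin (X * (suc n ^ n * (suc (n * C) * suc C))) → Fin n → Fin (suc n)
  profile j = finToFun (quotient (suc (n * C) * suc C) (remainder {X} _ j))
  segment : (Fin n → Fin (suc n)) → Fin (suc (n * C)) → Fin (suc C) → Fin (X * (suc n ^ n * (suc (n * C) * suc C)))
  segment d g s = combine x₀ (combine (funToFin d) (combine g s))
  segment-injective : ∀ d {g s g′ s′} → segment d g s ≡ segment d g′ s′ → g ≡ g′ × s ≡ s′
  segment-injective d {g} {s} {g′} {s′} e = combine-injective g s g′ s′
    (proj₂ (combine-injective (funToFin d) _ (funToFin d) _ (proj₂ (combine-injective x₀ _ x₀ _ e))))
  segment-consecutive : ∀ d g s → toℕ (segment d g (suc s)) ≡ suc (toℕ (segment d g (inject₁ s)))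
  segment-consecutive d g s =
    toℕ-combine-suc x₀ (toℕ-combine-suc (funToFin d) (toℕ-combine-suc g (cong suc (sym (toℕ-inject₁ s)))))
  profile-segment : ∀ d g s → profile (segment d g s) ≗ d
  profile-segment d g s i
    rewrite remainder-combine x₀ (combine (funToFin d) (combine g s))
          | quotient-combine (funToFin d) (combine g s) = finToFun-funToFin d i
  open PathJoin profile segment segment-injective segment-consecutive profile-segment

lemma5 : ∀ (C t : ℕ) → 1 ≤ C → 1 ≤ t →
    Σ ℕ λ m → (1 ≤ m) × (ChiListClusteredGE (K t m) C (t + 1) × ChiListClusteredGE (IP (t ∸ 1) m) C (t + 1))
lemma5 C (suc n) _ _ = mK * mI , *-mono-≤ 1≤mK 1≤mI , χ-K>t (suc n) C mI (fromℕ< 1≤mI) , χ-IP>t n C mK (fromℕ< 1≤mK)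
  where
  mK mI : ℕ
  mK = suc n ^ suc n * suc (suc n * C)
  mI = suc n ^ n * (suc (n * C) * suc C)
  1≤mK : 1 ≤ mK
  1≤mK = *-mono-≤ (m^n>0 (suc n) (suc n)) (s≤s z≤n)
  1≤mI : 1 ≤ mI
  1≤mI = *-mono-≤ (m^n>0 (suc n) n) (s≤s z≤n)
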